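{- Let $n,m\ge1$. A function $f:\mathbb{Z}/n\mathbb{Z}\to\mathbb{Z}/m\mathbb{Z}$ is congruence preserving if and only if there exist $p<\min(n,\mu(m))$ and $a_0,\dots,a_p\in\mathbb{Z}/m\mathbb{Z}$ such that $f(x)=\sum_{k=0}^{p}a_k\,\big(\binom{x}{k}\bmod m\big)$ for all $x\in\{0,\dots,n-1\}$ and, for all $k\le p$, $\mathrm{lcm}(k)$ divides $a_k$ in $\mathbb{Z}/m\mathbb{Z}$.
   Context: Elements of $\mathbb{Z}/n\mathbb{Z}$ are represented by $\{0,\dots,n-1\}$. A function $f:\mathbb{Z}/n\mathbb{Z}\to\mathbb{Z}/m\mathbb{Z}$ is congruence preserving if for every positive divisor $d$ of $m$ and all $a,b\in\{0,\dots,n-1\}$, $a\equiv b\pmod d$ implies $f(a)\equiv f(b)\pmod d$. For $k\ge1$, $\mathrm{lcm}(k)$ is the least common multiple of $1,\dots,k$, and $\mathrm{lcm}(0)=1$; it is viewed as an element of $\mathbb{Z}/m\mathbb{Z}$, and $c$ divides $a$ in $\mathbb{Z}/m\mathbb{Z}$ if $a=ct$ for some $t\in\mathbb{Z}/m\mathbb{Z}$. For $m$ with prime factorization $m=p_1^{\alpha_1}\cdots p_\ell^{\alpha_\ell}$, $\mu(m)=\max_{i}p_i^{\alpha_i}$ is the largest prime power dividing $m$. -}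

module Defs where

open import Data.Nat using (ℕ; zero; suc; _+_; _*_; _^_; _<_; _≤_; _⊔_; _⊓_; NonZero; _≟_)
open import Data.Nat.Properties using (anyUpTo?)
open import Data.Nat.DivMod using (_%_)
open import Data.Nat.Divisibility using (_∣_; _∣?_)
open import Data.Nat.Primality using (Prime; prime?)
open import Data.Nat.LCM using (lcm)
open import Data.Nat.Combinatorics using (_C_)
open import Data.Fin as Fin using (Fin; toℕ)
open import Data.Bool using (if_then_else_)
open import Data.List using (List; upTo; foldr)
open import Data.Product using (Σ; ∃; _×_; _,_)
open import Relation.Binary.PropositionalEquality using (_≡_)
open import Relation.Nullary using (Dec; yes; no)
open import Relation.Nullary.Decidable using (_×-dec_; ⌊_⌋)

-- Elements of ℤ/mℤ are represented by Fin m = {0,…,m-1}.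

CongruencePreserving : (n m : ℕ) → (Fin n → Fin m) → Set
CongruencePreserving n m f =
  ∀ (d : ℕ) .{{_ : NonZero d}} → d ∣ m →
  ∀ (a b : Fin n) → toℕ a % d ≡ toℕ b % d → toℕ (f a) % d ≡ toℕ (f b) % d

lcmUpTo : ℕ → ℕ
lcmUpTo zero    = 1
lcmUpTo (suc k) = lcm (suc k) (lcmUpTo k)

DividesMod : (m : ℕ) .{{_ : NonZero m}} → ℕ → Fin m → Set
DividesMod m c a = Σ (Fin m) λ t → toℕ a ≡ (c * toℕ t) % m

-- q is a prime power p^α (α ≥ 0, so 1 counts as p^0)
PrimePower : ℕ → Set
PrimePower q = ∃ λ p → p < suc q × (Prime p × (∃ λ α → α < suc q × p ^ α ≡ q))

primePower? : ∀ q → Dec (PrimePower q)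
primePower? q = anyUpTo? (λ p → prime? p ×-dec anyUpTo? (λ α → p ^ α ≟ q) (suc q)) (suc q)

-- μ(m) = largest prime power dividing m (μ(1) = 1, as 1 = p^0)
μ : ℕ → ℕ
μ m = foldr step 1 (upTo (suc m))
  where
  step : ℕ → ℕ → ℕ
  step q acc = if ⌊ (q ∣? m) ×-dec primePower? q ⌋ then q ⊔ acc else acc

sumFin : ∀ {k} → (Fin k → ℕ) → ℕ
sumFin {zero}  g = 0
sumFin {suc k} g = g Fin.zero + sumFin (λ i → g (Fin.suc i))

module Submission where

-- Sufficiency rests on one binomial fact: lcm(k)·C(y+h,k) − lcm(k)·C(y,k) is a multiple
-- of h (induction with Pascal's rule and the absorption identity), so x ↦ lcm(k)·C(x,k)
-- preserves every congruence, and therefore so does each term a_k·C(x,k).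
--
-- Necessity uses Newton interpolation: coefficients c_k chosen so that Σ_{j≤k} c_j·C(x,j)
-- agrees with f at 0,…,k.  By induction on k, congruence preservation forces every j ≤ k
-- dividing m to divide c_k; then gcd(lcm(k), m) ∣ c_k (gcd distributes over lcm), so
-- lcm(k) ∣ c_k in ℤ/mℤ by Bézout.  When k ≥ μ(m) every prime power dividing m divides
-- c_k, so m ∣ c_k (local-global principle, via p-adic decompositions) and c_k = 0.

open import Defs
open import Data.Bool using (if_then_else_)
open import Data.Empty using (⊥-elim)
open import Data.Fin as Fin using (Fin; toℕ; fromℕ<)
open import Data.Fin.Properties using (toℕ<n; toℕ-fromℕ<; toℕ-injective)
open import Data.List using ([]; _∷_; upTo; foldr)
open import Data.List.Membership.Propositional using (_∈_)
open import Data.List.Membership.Propositional.Properties using (∈-upTo⁺)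
open import Data.List.Relation.Unary.All using (_∷_)
open import Data.List.Relation.Unary.Any using (here; there)
open import Data.Nat using (ℕ; zero; suc; _+_; _*_; _∸_; _^_; _<_; _≤_; _⊓_; _⊔_; NonZero; z≤n; s≤s; pred; ≢-nonZero; ≢-nonZero⁻¹; >-nonZero⁻¹; >-nonZero; nonTrivial⇒n>1)
open import Data.Nat.Properties
open import Data.Nat.DivMod
open import Data.Nat.Divisibility
open import Data.Nat.Combinatorics using (_C_; nCn≡1; nC1≡n; k>n⇒nCk≡0; nCk+nC[k+1]≡[n+1]C[k+1])
open import Data.Nat.Coprimality using (Coprime; gcd≡1⇒coprime; coprime-divisor)
open import Data.Nat.GCD using (gcd; gcd[m,n]∣m; gcd[m,n]∣n; gcd-greatest; gcd[m,n]≢0; c*gcd[m,n]≡gcd[cm,cn]; gcd-zeroˡ; module Bézout; gcd-GCD)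
open import Data.Nat.Induction using (<-rec)
open import Data.Nat.LCM using (lcm; m∣lcm[m,n]; n∣lcm[m,n]; lcm-least; gcd*lcm)
open import Data.Nat.ListAction using (product)
open import Data.Nat.Primality using (Prime; prime⇒irreducible; prime⇒nonZero; prime⇒nonTrivial)
open import Data.Nat.Primality.Factorisation using (factorise)
open import Data.Nat.Tactic.RingSolver using (solve-∀)
open import Data.Product using (Σ; ∃; ∃₂; _×_; _,_; proj₁)
open import Data.Sum using (inj₁; inj₂)
open import Function.Bundles using (_⇔_; mk⇔)
open import Relation.Nullary using (¬_; yes; no)
open import Relation.Nullary.Decidable using (_×-dec_; ⌊_⌋)
open import Relation.Binary.PropositionalEquality

infix 4 _≡_[mod_]
_≡_[mod_] : ℕ → ℕ → (d : ℕ) .{{_ : NonZero d}} → Set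
a ≡ b [mod d ] = a % d ≡ b % d

module _ {d : ℕ} .{{_ : NonZero d}} where

  mod-+ : ∀ {a b c e} → a ≡ b [mod d ] → c ≡ e [mod d ] → a + c ≡ b + e [mod d ]
  mod-+ {a} {b} {c} {e} p q = begin
    (a + c) % d           ≡⟨ %-distribˡ-+ a c d ⟩
    (a % d + c % d) % d   ≡⟨ cong₂ (λ x y → (x + y) % d) p q ⟩
    (b % d + e % d) % d   ≡⟨ %-distribˡ-+ b e d ⟨
    (b + e) % d           ∎
    where open ≡-Reasoning

  mod-* : ∀ {a b c e} → a ≡ b [mod d ] → c ≡ e [mod d ] → a * c ≡ b * e [mod d ]
  mod-* {a} {b} {c} {e} p q = begin
    (a * c) % d           ≡⟨ %-distribˡ-* a c d ⟩
    (a % d * (c % d)) % d ≡⟨ cong₂ (λ x y → (x * y) % d) p q ⟩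
    (b % d * (e % d)) % d ≡⟨ %-distribˡ-* b e d ⟨
    (b * e) % d           ∎
    where open ≡-Reasoning

  mod-residue : ∀ a → a % d ≡ a [mod d ]
  mod-residue a = m%n%n≡m%n a d

  mod-+-multiple : ∀ {h} a s → d ∣ h → a + h * s ≡ a [mod d ]
  mod-+-multiple {h} a s (divides q refl) =
    trans (cong (λ z → (a + z) % d) (reorder q d s)) ([m+kn]%n≡m%n a (q * s) d)
    where
    reorder : ∀ q d s → q * d * s ≡ q * s * d
    reorder = solve-∀

  mod-cancel : ∀ {a s} → a + s ≡ s [mod d ] → d ∣ a
  mod-cancel {a} {s} p = ∣m+n∣m⇒∣n (divides ((a + s) / d) shifted) (n∣m*n (s / d))
    where
    shifted : s / d * d + a ≡ (a + s) / d * d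
    shifted = +-cancelʳ-≡ (s % d) _ _ (begin
      s / d * d + a + s % d           ≡⟨ rearrange (s / d * d) a (s % d) ⟩
      a + (s % d + s / d * d)         ≡⟨ cong (a +_) (m≡m%n+[m/n]*n s d) ⟨
      a + s                           ≡⟨ m≡m%n+[m/n]*n (a + s) d ⟩
      (a + s) % d + (a + s) / d * d   ≡⟨ cong (_+ (a + s) / d * d) p ⟩
      s % d + (a + s) / d * d         ≡⟨ +-comm (s % d) _ ⟩
      (a + s) / d * d + s % d         ∎)
      where
      open ≡-Reasoning
      rearrange : ∀ x y z → x + y + z ≡ y + (z + x)
      rearrange = solve-∀

  mod-divisor : ∀ {e a b} .{{_ : NonZero e}} → e ∣ d → a ≡ b [mod d ] → a ≡ b [mod e ]
  mod-divisor {e} {a} {b} e∣d p = begin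
    a % e       ≡⟨ m∣n⇒o%n%m≡o%m e d a e∣d ⟨
    a % d % e   ≡⟨ cong (_% e) p ⟩
    b % d % e   ≡⟨ m∣n⇒o%n%m≡o%m e d b e∣d ⟩
    b % e       ∎
    where open ≡-Reasoning

absorption : ∀ h k → suc k * (suc h C suc k) ≡ suc h * (h C k)
absorption h zero = trans (+-identityʳ (suc h C 1)) (trans (nC1≡n (suc h)) (sym (*-identityʳ (suc h))))
absorption zero (suc k) = *-zeroʳ (2 + k)
absorption (suc h) (suc k) = begin
  (2 + k) * (suc (suc h) C (2 + k))             ≡⟨ cong ((2 + k) *_) (nCk+nC[k+1]≡[n+1]C[k+1] (suc h) (suc k)) ⟨
  (2 + k) * (X + Y)                             ≡⟨ expand k X Y ⟩
  X + (suc k * X + (2 + k) * Y)                 ≡⟨ cong (X +_) (cong₂ _+_ (absorption h k) (absorption h (suc k))) ⟩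
  X + (suc h * (h C k) + suc h * (h C suc k))   ≡⟨ cong (X +_) (*-distribˡ-+ (suc h) (h C k) (h C suc k)) ⟨
  X + suc h * (h C k + h C suc k)               ≡⟨ cong (λ z → X + suc h * z) (nCk+nC[k+1]≡[n+1]C[k+1] h k) ⟩
  (2 + h) * X                                   ∎
  where
  open ≡-Reasoning
  X : ℕ
  X = suc h C suc k
  Y : ℕ
  Y = suc h C suc (suc k)
  expand : ∀ k X Y → (2 + k) * (X + Y) ≡ X + (suc k * X + (2 + k) * Y)
  expand = solve-∀

-- lcm(k+1)·C(h,k+1) is a multiple of h, since (k+1) ∣ lcm(k+1) and by absorption.
lcm-binomial-multiple : ∀ h k → ∃ λ s → lcmUpTo (suc k) * (h C suc k) ≡ h * s
lcm-binomial-multiple zero k = 0 , *-zeroʳ (lcmUpTo (suc k))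
lcm-binomial-multiple (suc h) k with m∣lcm[m,n] (suc k) (lcmUpTo k)
... | divides e lcm≡e*[k+1] = e * (h C k) , (begin
  lcmUpTo (suc k) * (suc h C suc k)     ≡⟨ cong (_* (suc h C suc k)) lcm≡e*[k+1] ⟩
  e * suc k * (suc h C suc k)           ≡⟨ *-assoc e (suc k) _ ⟩
  e * (suc k * (suc h C suc k))         ≡⟨ cong (e *_) (absorption h k) ⟩
  e * (suc h * (h C k))                 ≡⟨ swap e (suc h) (h C k) ⟩
  suc h * (e * (h C k))                 ∎)
  where
  open ≡-Reasoning
  swap : ∀ a b c → a * (b * c) ≡ b * (a * c)
  swap = solve-∀

lcm-binomial-shift : ∀ y h k → ∃ λ s → lcmUpTo k * ((y + h) C k) ≡ lcmUpTo k * (y C k) + h * s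
lcm-binomial-shift y h zero = 0 , cong suc (sym (*-zeroʳ h))
lcm-binomial-shift zero h (suc k) with lcm-binomial-multiple h k
... | s , eq = s , trans eq (cong (_+ h * s) (sym (*-zeroʳ (lcmUpTo (suc k)))))
lcm-binomial-shift (suc y) h (suc k)
  with lcm-binomial-shift y h k | lcm-binomial-shift y h (suc k) | n∣lcm[m,n] (suc k) (lcmUpTo k)
... | s₀ , ih₀ | s₁ , ih₁ | divides e L′≡e*L = e * s₀ + s₁ , (begin
  L′ * (suc (y + h) C suc k)                      ≡⟨ cong (L′ *_) (pascal (y + h)) ⟨
  L′ * ((y + h) C k + (y + h) C suc k)            ≡⟨ *-distribˡ-+ L′ _ _ ⟩
  L′ * ((y + h) C k) + L′ * ((y + h) C suc k)     ≡⟨ cong₂ _+_ (scale ((y + h) C k)) ih₁ ⟩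
  e * (L * ((y + h) C k)) + (L′ * (y C suc k) + h * s₁)
                                                  ≡⟨ cong (λ z → e * z + (L′ * (y C suc k) + h * s₁)) ih₀ ⟩
  e * (L * (y C k) + h * s₀) + (L′ * (y C suc k) + h * s₁)
                                                  ≡⟨ collect e L (y C k) h s₀ (L′ * (y C suc k)) s₁ ⟩
  e * (L * (y C k)) + L′ * (y C suc k) + h * (e * s₀ + s₁)
                                                  ≡⟨ cong (λ z → z + L′ * (y C suc k) + h * (e * s₀ + s₁)) (scale (y C k)) ⟨
  L′ * (y C k) + L′ * (y C suc k) + h * (e * s₀ + s₁)
                                                  ≡⟨ cong (_+ h * (e * s₀ + s₁)) (*-distribˡ-+ L′ _ _) ⟨
  L′ * (y C k + y C suc k) + h * (e * s₀ + s₁)    ≡⟨ cong (λ z → L′ * z + h * (e * s₀ + s₁)) (pascal y) ⟩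
  L′ * (suc y C suc k) + h * (e * s₀ + s₁)        ∎)
  where
  open ≡-Reasoning
  L : ℕ
  L = lcmUpTo k
  L′ : ℕ
  L′ = lcmUpTo (suc k)
  pascal : ∀ x → x C k + x C suc k ≡ suc x C suc k
  pascal x = nCk+nC[k+1]≡[n+1]C[k+1] x k
  scale : ∀ x → L′ * x ≡ e * (L * x)
  scale x = trans (cong (_* x) L′≡e*L) (*-assoc e L x)
  collect : ∀ e L c h s₀ b s₁ → e * (L * c + h * s₀) + (b + h * s₁) ≡ e * (L * c) + b + h * (e * s₀ + s₁)
  collect = solve-∀

lcm-binomial-congruence-≤ : ∀ {d} .{{_ : NonZero d}} k {x y} → y ≤ x → x ≡ y [mod d ] →
  lcmUpTo k * (x C k) ≡ lcmUpTo k * (y C k) [mod d ]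
lcm-binomial-congruence-≤ {d} k {x} {y} y≤x x≡y with lcm-binomial-shift y (x ∸ y) k
... | s , shift = begin
  (L * (x C k)) % d           ≡⟨ cong (λ z → (L * (z C k)) % d) y+h≡x ⟨
  (L * ((y + h) C k)) % d     ≡⟨ cong (_% d) shift ⟩
  (L * (y C k) + h * s) % d   ≡⟨ mod-+-multiple (L * (y C k)) s d∣h ⟩
  (L * (y C k)) % d           ∎
  where
  open ≡-Reasoning
  L : ℕ
  L = lcmUpTo k
  h : ℕ
  h = x ∸ y
  y+h≡x : y + h ≡ x
  y+h≡x = m+[n∸m]≡n y≤x
  d∣h : d ∣ h
  d∣h = mod-cancel (trans (cong (_% d) (trans (+-comm h y) y+h≡x)) x≡y)

lcm-binomial-congruence : ∀ {d} .{{_ : NonZero d}} k {x y} → x ≡ y [mod d ] →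
  lcmUpTo k * (x C k) ≡ lcmUpTo k * (y C k) [mod d ]
lcm-binomial-congruence k {x} {y} x≡y with ≤-total y x
... | inj₁ y≤x = lcm-binomial-congruence-≤ k y≤x x≡y
... | inj₂ x≤y = sym (lcm-binomial-congruence-≤ k x≤y (sym x≡y))

sumFin-congruence : ∀ {d} .{{_ : NonZero d}} {K} (g h : Fin K → ℕ) →
  (∀ i → g i ≡ h i [mod d ]) → sumFin g ≡ sumFin h [mod d ]
sumFin-congruence {K = zero} g h g≡h = refl
sumFin-congruence {K = suc K} g h g≡h =
  mod-+ (g≡h Fin.zero) (sumFin-congruence (λ i → g (Fin.suc i)) (λ i → h (Fin.suc i)) (λ i → g≡h (Fin.suc i)))

expansion : ∀ {m} .{{_ : NonZero m}} {K} → (Fin K → Fin m) → ℕ → ℕ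
expansion {m} a x = sumFin (λ k → toℕ (a k) * ((x C toℕ k) % m))

module _ {m : ℕ} .{{_ : NonZero m}} {d : ℕ} .{{_ : NonZero d}} (d∣m : d ∣ m) where

  term-unfold : ∀ {A c} k t x → A ≡ lcmUpTo k * t [mod m ] → c ≡ x C k [mod m ] →
    A * c ≡ t * (lcmUpTo k * (x C k)) [mod d ]
  term-unfold {A} k t x A≡Lt c≡C =
    trans (mod-* (mod-divisor d∣m A≡Lt) (mod-divisor d∣m c≡C))
          (cong (_% d) (reorder (lcmUpTo k) t (x C k)))
    where
    reorder : ∀ L t c → L * t * c ≡ t * (L * c)
    reorder = solve-∀

  term-congruence : ∀ {A c c′} k t {x y} → A ≡ lcmUpTo k * t [mod m ] →
    c ≡ x C k [mod m ] → c′ ≡ y C k [mod m ] → x ≡ y [mod d ] → A * c ≡ A * c′ [mod d ]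
  term-congruence k t {x} {y} A≡Lt c≡C c′≡C x≡y =
    trans (term-unfold k t x A≡Lt c≡C)
      (trans (mod-* {a = t} refl (lcm-binomial-congruence k x≡y)) (sym (term-unfold k t y A≡Lt c′≡C)))

dividesMod⇒congruence : ∀ {m} .{{_ : NonZero m}} {c a} (c∣a : DividesMod m c a) →
  toℕ a ≡ c * toℕ (proj₁ c∣a) [mod m ]
dividesMod⇒congruence {m} {c} (t , a≡ct) = trans (cong (_% m) a≡ct) (mod-residue (c * toℕ t))

congruence⇒dividesMod : ∀ {m} .{{_ : NonZero m}} {c} {a : Fin m} t → toℕ a ≡ c * t [mod m ] → DividesMod m c a
congruence⇒dividesMod {m} {c} {a} t a≡ct = fromℕ< (m%n<n t m) , (begin
  toℕ a                            ≡⟨ m<n⇒m%n≡m (toℕ<n a) ⟨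
  toℕ a % m                        ≡⟨ a≡ct ⟩
  (c * t) % m                      ≡⟨ mod-* {a = c} refl (mod-residue t) ⟨
  (c * (t % m)) % m                ≡⟨ cong (λ z → (c * z) % m) (toℕ-fromℕ< (m%n<n t m)) ⟨
  (c * toℕ (fromℕ< (m%n<n t m))) % m ∎)
  where open ≡-Reasoning

sufficiency : ∀ n m .{{_ : NonZero m}} (f : Fin n → Fin m) {K} (a : Fin K → Fin m) →
  (∀ x → toℕ (f x) ≡ expansion a (toℕ x) % m) →
  (∀ k → DividesMod m (lcmUpTo (toℕ k)) (a k)) →
  CongruencePreserving n m f
sufficiency n m f a f≡expansion lcm∣a d d∣m x y x≡y = begin
  toℕ (f x) % d                   ≡⟨ cong (_% d) (f≡expansion x) ⟩
  expansion a (toℕ x) % m % d     ≡⟨ m∣n⇒o%n%m≡o%m d m _ d∣m ⟩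
  expansion a (toℕ x) % d         ≡⟨ sumFin-congruence _ _ termwise ⟩
  expansion a (toℕ y) % d         ≡⟨ m∣n⇒o%n%m≡o%m d m _ d∣m ⟨
  expansion a (toℕ y) % m % d     ≡⟨ cong (_% d) (f≡expansion y) ⟨
  toℕ (f y) % d                   ∎
  where
  open ≡-Reasoning
  termwise : ∀ k → toℕ (a k) * ((toℕ x C toℕ k) % m) ≡ toℕ (a k) * ((toℕ y C toℕ k) % m) [mod d ]
  termwise k = term-congruence d∣m (toℕ k) (toℕ (proj₁ (lcm∣a k)))
    (dividesMod⇒congruence {c = lcmUpTo (toℕ k)} (lcm∣a k)) (mod-residue _) (mod-residue _) x≡y

-- x ∣ lcm(A,B) implies x ∣ lcm(gcd(x,A), gcd(x,B)): the divisibility half of the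
-- distributive law gcd(x, lcm(A,B)) = lcm(gcd(x,A), gcd(x,B)).
divides-lcm-of-gcds : ∀ x A B .{{_ : NonZero x}} → x ∣ lcm A B → x ∣ lcm (gcd x A) (gcd x B)
divides-lcm-of-gcds x A B (divides q lcm≡qx) = *-cancelʳ-∣ g {{g≢0}} (begin
  x * g                 ∣⟨ gcd-greatest xg∣ux xg∣uB ⟩
  gcd (u * x) (u * B)   ≡⟨ c*gcd[m,n]≡gcd[cm,cn] u x B ⟨
  u * v                 ≡⟨ gcd*lcm u v ⟨
  g * lcm u v           ≡⟨ *-comm g (lcm u v) ⟩
  lcm u v * g           ∎)
  where
  open ∣-Reasoning
  u : ℕ
  u = gcd x A
  v : ℕ
  v = gcd x B
  g : ℕ
  g = gcd u v
  g≢0 : NonZero g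
  g≢0 = ≢-nonZero (gcd[m,n]≢0 u v (inj₁ (gcd[m,n]≢0 x A (inj₁ (≢-nonZero⁻¹ x)))))
  g∣B : g ∣ B
  g∣B = ∣-trans (gcd[m,n]∣n u v) (gcd[m,n]∣n x B)
  g∣gcd[A,B] : g ∣ gcd A B
  g∣gcd[A,B] = gcd-greatest (∣-trans (gcd[m,n]∣m u v) (gcd[m,n]∣n x A)) g∣B
  xg∣ux : x * g ∣ u * x
  xg∣ux = subst (x * g ∣_) (*-comm x u) (*-monoʳ-∣ x (gcd[m,n]∣m u v))
  -- x·gcd(A,B) ∣ A·B because A·B = gcd(A,B)·lcm(A,B) and x ∣ lcm(A,B)
  x*gcd∣A*B : x * gcd A B ∣ A * B
  x*gcd∣A*B = divides q (begin-equality
    A * B                 ≡⟨ gcd*lcm A B ⟨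
    gcd A B * lcm A B     ≡⟨ cong (gcd A B *_) lcm≡qx ⟩
    gcd A B * (q * x)     ≡⟨ rotate (gcd A B) q x ⟩
    q * (x * gcd A B)     ∎)
    where
    rotate : ∀ a b c → a * (b * c) ≡ b * (c * a)
    rotate = solve-∀
  xg∣uB : x * g ∣ u * B
  xg∣uB = begin
    x * g                 ∣⟨ gcd-greatest xg∣Bx xg∣BA ⟩
    gcd (B * x) (B * A)   ≡⟨ c*gcd[m,n]≡gcd[cm,cn] B x A ⟨
    B * u                 ≡⟨ *-comm B u ⟩
    u * B                 ∎
    where
    xg∣Bx : x * g ∣ B * x
    xg∣Bx = subst (x * g ∣_) (*-comm x B) (*-monoʳ-∣ x g∣B)
    xg∣BA : x * g ∣ B * A
    xg∣BA = begin
      x * g                 ∣⟨ *-monoʳ-∣ x g∣gcd[A,B] ⟩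
      x * gcd A B           ∣⟨ x*gcd∣A*B ⟩
      A * B                 ≡⟨ *-comm A B ⟩
      B * A                 ∎

gcd-lcmUpTo-divides : ∀ k m c .{{_ : NonZero m}} →
  (∀ j → 1 ≤ j → j ≤ k → j ∣ m → j ∣ c) → gcd (lcmUpTo k) m ∣ c
gcd-lcmUpTo-divides zero m c _ = subst (_∣ c) (sym (gcd-zeroˡ m)) (1∣ c)
gcd-lcmUpTo-divides (suc k) m c small∣c = begin
  x                                   ∣⟨ divides-lcm-of-gcds x (suc k) L (gcd[m,n]∣m (lcmUpTo (suc k)) m) ⟩
  lcm (gcd x (suc k)) (gcd x L)       ∣⟨ lcm-least j∣c gcd[x,L]∣c ⟩
  c                                   ∎
  where
  open ∣-Reasoning
  L : ℕ
  L = lcmUpTo k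
  x : ℕ
  x = gcd (lcmUpTo (suc k)) m
  x∣m : x ∣ m
  x∣m = gcd[m,n]∣n (lcmUpTo (suc k)) m
  instance
    x≢0 : NonZero x
    x≢0 = ≢-nonZero (gcd[m,n]≢0 (lcmUpTo (suc k)) m (inj₂ (≢-nonZero⁻¹ m)))
  j∣c : gcd x (suc k) ∣ c
  j∣c = small∣c (gcd x (suc k))
    (>-nonZero⁻¹ _ {{≢-nonZero (gcd[m,n]≢0 x (suc k) (inj₂ λ ()))}})
    (∣⇒≤ (gcd[m,n]∣n x (suc k)))
    (∣-trans (gcd[m,n]∣m x (suc k)) x∣m)
  gcd[x,L]∣c : gcd x L ∣ c
  gcd[x,L]∣c = ∣-trans (gcd-greatest (gcd[m,n]∣n x L) (∣-trans (gcd[m,n]∣m x L) x∣m))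
    (gcd-lcmUpTo-divides k m c (λ j 1≤j j≤k → small∣c j 1≤j (m≤n⇒m≤1+n j≤k)))

equation⇒congruence : ∀ {m} .{{_ : NonZero m}} {c b} a e → c + a * m ≡ b + e * m → c ≡ b [mod m ]
equation⇒congruence {m} {c} {b} a e eq =
  trans (sym ([m+kn]%n≡m%n c a m)) (trans (cong (_% m) eq) ([m+kn]%n≡m%n b e m))

gcd-divides⇒dividesMod : ∀ L m c .{{_ : NonZero m}} → gcd L m ∣ c → ∃ λ t → c ≡ L * t [mod m ]
gcd-divides⇒dividesMod L m c (divides s c≡sg) with Bézout.identity (gcd-GCD L m)
... | Bézout.+- x y g+ym≡xL = s * x , equation⇒congruence (s * y) 0 (begin
  c + s * y * m         ≡⟨ cong (_+ s * y * m) c≡sg ⟩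
  s * g + s * y * m     ≡⟨ factor s g y m ⟩
  s * (g + y * m)       ≡⟨ cong (s *_) g+ym≡xL ⟩
  s * (x * L)           ≡⟨ rearrange s x L ⟩
  L * (s * x) + 0 * m   ∎)
  where
  open ≡-Reasoning
  g : ℕ
  g = gcd L m
  factor : ∀ s g y m → s * g + s * y * m ≡ s * (g + y * m)
  factor = solve-∀
  rearrange : ∀ s x L → s * (x * L) ≡ L * (s * x) + 0
  rearrange = solve-∀
... | Bézout.-+ x y g+xL≡ym = s * x * pred m , equation⇒congruence (L * s * x) (s * y) (begin
  c + L * s * x * m                       ≡⟨ cong (λ z → c + L * s * x * z) (suc-pred m) ⟨
  c + L * s * x * suc (pred m)            ≡⟨ split c L s x (pred m) ⟩
  (c + s * x * L) + L * (s * x * pred m)  ≡⟨ cong (λ z → z + s * x * L + L * (s * x * pred m)) c≡sg ⟩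
  (s * g + s * x * L) + L * (s * x * pred m)
                                          ≡⟨ cong (_+ L * (s * x * pred m)) (factor s g x L) ⟩
  s * (g + x * L) + L * (s * x * pred m)  ≡⟨ cong (λ z → s * z + L * (s * x * pred m)) g+xL≡ym ⟩
  s * (y * m) + L * (s * x * pred m)      ≡⟨ swap s y m (L * (s * x * pred m)) ⟩
  L * (s * x * pred m) + s * y * m        ∎)
  where
  open ≡-Reasoning
  g : ℕ
  g = gcd L m
  split : ∀ c L s x p → c + L * s * x * suc p ≡ (c + s * x * L) + L * (s * x * p)
  split = solve-∀
  factor : ∀ s g x L → s * g + s * x * L ≡ s * (g + x * L)
  factor = solve-∀
  swap : ∀ s y m z → s * (y * m) + z ≡ z + s * y * m
  swap = solve-∀

prime>1 : ∀ {p} → Prime p → 1 < p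
prime>1 {p} pp = nonTrivial⇒n>1 p {{prime⇒nonTrivial pp}}

prime-divisor : ∀ m .{{_ : NonZero m}} → 2 ≤ m → ∃ λ p → Prime p × p ∣ m
prime-divisor m 2≤m with factorise m
... | record { factors = [] ; isFactorisation = m≡1 } = ⊥-elim (<⇒≢ 2≤m (sym m≡1))
... | record { factors = p ∷ ps ; isFactorisation = m≡p*ps ; factorsPrime = p-prime ∷ _ } =
  p , p-prime , divides (product ps) (trans m≡p*ps (*-comm p (product ps)))

p-adic-decomposition : ∀ {p} → Prime p → ∀ m → NonZero m → ∃₂ λ a r → m ≡ p ^ a * r × ¬ p ∣ r
p-adic-decomposition {p} pp = <-rec _ decompose
  where
  instance p≢0 = prime⇒nonZero pp
  decompose : ∀ m → (∀ {q} → q < m → NonZero q → ∃₂ λ a r → q ≡ p ^ a * r × ¬ p ∣ r) →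
              NonZero m → ∃₂ λ a r → m ≡ p ^ a * r × ¬ p ∣ r
  decompose m rec m≢0 with p ∣? m
  ... | no p∤m = 0 , m , sym (+-identityʳ m) , p∤m
  ... | yes (divides q m≡qp) with rec q<m q≢0
    where
    q≢0 : NonZero q
    q≢0 = ≢-nonZero λ q≡0 → ≢-nonZero⁻¹ m {{m≢0}} (trans m≡qp (cong (_* p) q≡0))
    q<m : q < m
    q<m = subst (q <_) (sym m≡qp) (m<m*n q p {{q≢0}} (prime>1 pp))
  ... | a , r , q≡pᵃr , p∤r = suc a , r , (begin
    m               ≡⟨ m≡qp ⟩
    q * p           ≡⟨ cong (_* p) q≡pᵃr ⟩
    p ^ a * r * p   ≡⟨ *-comm _ p ⟩
    p * (p ^ a * r) ≡⟨ *-assoc p (p ^ a) r ⟨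
    p ^ suc a * r   ∎) , p∤r
    where open ≡-Reasoning

prime∤⇒coprime : ∀ {p r} → Prime p → ¬ p ∣ r → Coprime r p
prime∤⇒coprime {p} {r} pp p∤r with prime⇒irreducible pp (gcd[m,n]∣n r p)
... | inj₁ gcd≡1 = gcd≡1⇒coprime gcd≡1
... | inj₂ gcd≡p = ⊥-elim (p∤r (subst (_∣ r) gcd≡p (gcd[m,n]∣m r p)))

prime-power-cancel : ∀ {p r} → Prime p → ¬ p ∣ r → ∀ a {u} → r ∣ p ^ a * u → r ∣ u
prime-power-cancel {r = r} pp p∤r zero {u} r∣u = subst (r ∣_) (+-identityʳ u) r∣u
prime-power-cancel {p} {r} pp p∤r (suc a) {u} r∣pᵃ⁺¹u = prime-power-cancel pp p∤r a
  (coprime-divisor (prime∤⇒coprime pp p∤r) (subst (r ∣_) (*-assoc p (p ^ a) u) r∣pᵃ⁺¹u))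

-- The exponent is below the power; needed for the bound on α in PrimePower.
a<p^a : ∀ {p} → 1 < p → ∀ a → a < p ^ a
a<p^a 1<p zero = s≤s z≤n
a<p^a {p} 1<p (suc a) = <-≤-trans (s≤s (a<p^a 1<p a)) (^-monoʳ-< p 1<p (n<1+n a))

prime-power : ∀ {p} → Prime p → ∀ a → PrimePower (p ^ suc a)
prime-power {p} pp a = p , s≤s (m≤m*n p (p ^ a) {{m^n≢0 p a {{prime⇒nonZero pp}}}}) , pp ,
  suc a , s≤s (<⇒≤ (a<p^a (prime>1 pp) (suc a))) , refl

power-and-cofactor-divide : ∀ {p r c} → Prime p → ¬ p ∣ r → ∀ a → p ^ a ∣ c → r ∣ c → p ^ a * r ∣ c
power-and-cofactor-divide {p} {r} pp p∤r a (divides w refl) r∣c =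
  subst (p ^ a * r ∣_) (*-comm (p ^ a) w)
    (*-monoʳ-∣ (p ^ a) (prime-power-cancel pp p∤r a (subst (r ∣_) (*-comm w (p ^ a)) r∣c)))

PrimePowersDivide : ℕ → ℕ → Set
PrimePowersDivide m c = ∀ q → q ∣ m → PrimePower q → q ∣ c

primePowersDivide⇒divides : ∀ m .{{_ : NonZero m}} c → PrimePowersDivide m c → m ∣ c
primePowersDivide⇒divides m = <-rec _ step m (≢-nonZero (≢-nonZero⁻¹ m))
  where
  step : ∀ m → (∀ {r} → r < m → NonZero r → ∀ c → PrimePowersDivide r c → r ∣ c) →
         NonZero m → ∀ c → PrimePowersDivide m c → m ∣ c
  step m rec m≢0 c pp∣c with 2 ≤? m
  ... | no m≱2 = subst (_∣ c) (≤-antisym (>-nonZero⁻¹ m {{m≢0}}) (≤-pred (≰⇒> m≱2))) (1∣ c)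
  ... | yes 2≤m with prime-divisor m {{m≢0}} 2≤m
  ... | p , pp , p∣m with p-adic-decomposition pp m m≢0
  ... | zero , r , m≡1*r , p∤r = ⊥-elim (p∤r (subst (p ∣_) (trans m≡1*r (*-identityˡ r)) p∣m))
  ... | suc a , r , m≡Pr , p∤r =
    subst (_∣ c) (sym m≡Pr) (power-and-cofactor-divide pp p∤r (suc a) P∣c r∣c)
    where
    P : ℕ
    P = p ^ suc a
    r≢0 : NonZero r
    r≢0 = ≢-nonZero λ r≡0 → ≢-nonZero⁻¹ m {{m≢0}} (trans m≡Pr (trans (cong (P *_) r≡0) (*-zeroʳ P)))
    r<m : r < m
    r<m = subst (r <_) (trans (*-comm r P) (sym m≡Pr))
      (m<m*n r P {{r≢0}} (<-≤-trans (prime>1 pp) (m≤m*n p (p ^ a) {{m^n≢0 p a {{prime⇒nonZero pp}}}})))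
    P∣c : P ∣ c
    P∣c = pp∣c P (divides r (trans m≡Pr (*-comm P r))) (prime-power pp a)
    r∣c : r ∣ c
    r∣c = rec r<m r≢0 c (λ q q∣r → pp∣c q (∣-trans q∣r (divides P m≡Pr)))

module _ (m : ℕ) where

  μ-step : ℕ → ℕ → ℕ
  μ-step q acc = if ⌊ (q ∣? m) ×-dec primePower? q ⌋ then q ⊔ acc else acc

  μ-step-≥acc : ∀ q acc → acc ≤ μ-step q acc
  μ-step-≥acc q acc with (q ∣? m) ×-dec primePower? q
  ... | yes _ = m≤n⊔m q acc
  ... | no _  = ≤-refl

  μ-step-≥q : ∀ q acc → q ∣ m → PrimePower q → q ≤ μ-step q acc
  μ-step-≥q q acc q∣m ppq with (q ∣? m) ×-dec primePower? q
  ... | yes _ = m≤m⊔n q acc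
  ... | no ¬q∣m×ppq = ⊥-elim (¬q∣m×ppq (q∣m , ppq))

  foldr-μ-step-≥1 : ∀ l → 1 ≤ foldr μ-step 1 l
  foldr-μ-step-≥1 []      = ≤-refl
  foldr-μ-step-≥1 (q ∷ l) = ≤-trans (foldr-μ-step-≥1 l) (μ-step-≥acc q _)

  foldr-μ-step-≥ : ∀ q l → q ∈ l → q ∣ m → PrimePower q → q ≤ foldr μ-step 1 l
  foldr-μ-step-≥ q (q′ ∷ l) (here refl) q∣m ppq = μ-step-≥q q _ q∣m ppq
  foldr-μ-step-≥ q (q′ ∷ l) (there q∈l) q∣m ppq =
    ≤-trans (foldr-μ-step-≥ q l q∈l q∣m ppq) (μ-step-≥acc q′ _)

μ≥1 : ∀ m → 1 ≤ μ m
μ≥1 m = foldr-μ-step-≥1 m (upTo (suc m))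

primePower∣⇒≤μ : ∀ m .{{_ : NonZero m}} q → q ∣ m → PrimePower q → q ≤ μ m
primePower∣⇒≤μ m q q∣m ppq = foldr-μ-step-≥ m q (upTo (suc m)) (∈-upTo⁺ (s≤s (∣⇒≤ q∣m))) q∣m ppq

sumFin-snoc : ∀ K (g : ℕ → ℕ) → sumFin {suc K} (λ i → g (toℕ i)) ≡ sumFin {K} (λ i → g (toℕ i)) + g K
sumFin-snoc zero g = +-comm (g 0) 0
sumFin-snoc (suc K) g =
  trans (cong (g 0 +_) (sumFin-snoc K (λ k → g (suc k)))) (sym (+-assoc (g 0) _ (g (suc K))))

multiple<⇒≡0 : ∀ {m x} → m ∣ x → x < m → x ≡ 0
multiple<⇒≡0 {x = zero} _ _ = refl
multiple<⇒≡0 {x = suc x} m∣x x<m = ⊥-elim (<⇒≱ x<m (∣⇒≤ m∣x))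

-- The partial sums
--   newton k x = Σ_{j<k} coeff j · C(x,j)
-- use as k-th coefficient the residue of F(k) − newton k k, so that newton (k+1)
-- agrees with F modulo m at 0,…,k.
module Newton (m : ℕ) .{{_ : NonZero m}} (F : ℕ → ℕ) where

  -- The residue of X − s modulo m.
  infixl 6 _⊖_
  _⊖_ : ℕ → ℕ → ℕ
  X ⊖ s = (X + (m ∸ s % m)) % m

  ⊖-inverse : ∀ s X → s + (X ⊖ s) ≡ X [mod m ]
  ⊖-inverse s X = trans (mod-+ {a = s} refl (mod-residue (X + (m ∸ s % m))))
    (equation⇒congruence 0 (suc (s / m)) (begin
      s + (X + (m ∸ s % m)) + 0                 ≡⟨ +-identityʳ _ ⟩
      s + (X + (m ∸ s % m))                     ≡⟨ cong (_+ (X + (m ∸ s % m))) (m≡m%n+[m/n]*n s m) ⟩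
      s % m + s / m * m + (X + (m ∸ s % m))     ≡⟨ regroup (s % m) (s / m * m) X (m ∸ s % m) ⟩
      X + (s % m + (m ∸ s % m) + s / m * m)     ≡⟨ cong (λ z → X + (z + s / m * m)) (m+[n∸m]≡n (m%n≤n s m)) ⟩
      X + suc (s / m) * m                       ∎))
    where
    open ≡-Reasoning
    regroup : ∀ a b X e → a + b + (X + e) ≡ X + (a + e + b)
    regroup = solve-∀

  mutual
    coeff : ℕ → ℕ
    coeff k = F k ⊖ newton k k

    newton : ℕ → ℕ → ℕ
    newton zero    x = 0
    newton (suc k) x = newton k x + coeff k * (x C k)

  coeff<m : ∀ k → coeff k < m
  coeff<m k = m%n<n _ m

  newton-diagonal : ∀ k → newton (suc k) k ≡ newton k k + coeff k
  newton-diagonal k = cong (newton k k +_) (trans (cong (coeff k *_) (nCn≡1 k)) (*-identityʳ (coeff k)))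

  newton-interpolates : ∀ k x → x < k → newton k x ≡ F x [mod m ]
  newton-interpolates (suc k) x x<k+1 with m<1+n⇒m<n∨m≡n x<k+1
  ... | inj₁ x<k = trans (cong (_% m) vanishing) (newton-interpolates k x x<k)
    where
    vanishing : newton k x + coeff k * (x C k) ≡ newton k x
    vanishing = trans (cong (λ z → newton k x + coeff k * z) (k>n⇒nCk≡0 x<k))
                      (trans (cong (newton k x +_) (*-zeroʳ (coeff k))) (+-identityʳ _))
  ... | inj₂ refl = trans (cong (_% m) (newton-diagonal x)) (⊖-inverse (newton x x) (F x))

  LcmDivides : ℕ → Set
  LcmDivides k = ∃ λ t → coeff k ≡ lcmUpTo k * t [mod m ]

  newton-congruence : ∀ k → (∀ j → j < k → LcmDivides j) →
    ∀ {d} .{{_ : NonZero d}} → d ∣ m → ∀ {x y} → x ≡ y [mod d ] → newton k x ≡ newton k y [mod d ]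
  newton-congruence zero    _       d∣m x≡y = refl
  newton-congruence (suc k) lcm∣coeff d∣m x≡y with lcm∣coeff k ≤-refl
  ... | t , coeff≡Lt = mod-+
    (newton-congruence k (λ j j<k → lcm∣coeff j (m<n⇒m<1+n j<k)) d∣m x≡y)
    (term-congruence d∣m k t coeff≡Lt refl refl x≡y)

  newton-as-sum : ∀ k x → newton k x ≡ sumFin {k} (λ i → coeff (toℕ i) * (x C toℕ i))
  newton-as-sum zero    x = refl
  newton-as-sum (suc k) x = trans (cong (_+ coeff k * (x C k)) (newton-as-sum k x))
    (sym (sumFin-snoc k (λ j → coeff j * (x C j))))

  newton-truncate : ∀ N j x → (∀ k → N ≤ k → k < N + j → coeff k ≡ 0) → newton (N + j) x ≡ newton N x
  newton-truncate N zero    x _         = cong (λ z → newton z x) (+-identityʳ N)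
  newton-truncate N (suc j) x coeff≡0 = begin
    newton (N + suc j) x                          ≡⟨ cong (λ z → newton z x) (+-suc N j) ⟩
    newton (N + j) x + coeff (N + j) * (x C (N + j))
                                                  ≡⟨ cong (λ z → newton (N + j) x + z * (x C (N + j))) last≡0 ⟩
    newton (N + j) x + 0                          ≡⟨ +-identityʳ _ ⟩
    newton (N + j) x                              ≡⟨ newton-truncate N j x (λ k N≤k k<N+j → coeff≡0 k N≤k (widen k<N+j)) ⟩
    newton N x                                    ∎
    where
    open ≡-Reasoning
    widen : ∀ {k} → k < N + j → k < N + suc j
    widen k<N+j = <-≤-trans k<N+j (+-monoʳ-≤ N (n≤1+n j))
    last≡0 : coeff (N + j) ≡ 0
    last≡0 = coeff≡0 (N + j) (m≤m+n N j) (subst (N + j <_) (sym (+-suc N j)) ≤-refl)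

  module Preserving (n : ℕ)
    (F-cp : ∀ d .{{_ : NonZero d}} → d ∣ m → ∀ x y → x < n → y < n → x ≡ y [mod d ] → F x ≡ F y [mod d ])
    where

    -- Every j ∈ [1,k] dividing m divides the k-th coefficient.  Modulo j, with x = k − j:
    --   coeff k + newton k k = newton (k+1) k ≡ F k ≡ F x ≡ newton k x ≡ newton k k.
    small-divisor∣coeff : ∀ k → k < n → (∀ i → i < k → LcmDivides i) →
      ∀ j → 1 ≤ j → j ≤ k → j ∣ m → j ∣ coeff k
    small-divisor∣coeff k k<n lcm∣coeff j 1≤j j≤k j∣m = mod-cancel (begin
      (coeff k + newton k k) % j     ≡⟨ cong (_% j) (trans (+-comm (coeff k) _) (sym (newton-diagonal k))) ⟩
      newton (suc k) k % j           ≡⟨ mod-divisor j∣m (newton-interpolates (suc k) k ≤-refl) ⟩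
      F k % j                        ≡⟨ F-cp j j∣m k x k<n (<-trans x<k k<n) k≡x ⟩
      F x % j                        ≡⟨ mod-divisor j∣m (newton-interpolates k x x<k) ⟨
      newton k x % j                 ≡⟨ newton-congruence k lcm∣coeff j∣m (sym k≡x) ⟩
      newton k k % j                 ∎)
      where
      open ≡-Reasoning
      instance
        j≢0 : NonZero j
        j≢0 = >-nonZero 1≤j
      x : ℕ
      x = k ∸ j
      x<k : x < k
      x<k = ∸-monoʳ-< 1≤j j≤k
      k≡x : k ≡ x [mod j ]
      k≡x = trans (cong (_% j) (sym (m∸n+n≡m j≤k))) ([m+n]%n≡m%n x j)

    lcm∣coeffs : ∀ k → k ≤ n → ∀ j → j < k → LcmDivides j
    lcm∣coeffs (suc k) k+1≤n j j<k+1 with m<1+n⇒m<n∨m≡n j<k+1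
    ... | inj₁ j<k  = lcm∣coeffs k (<⇒≤ k+1≤n) j j<k
    ... | inj₂ refl = gcd-divides⇒dividesMod (lcmUpTo j) m (coeff j)
      (gcd-lcmUpTo-divides j m (coeff j) (small-divisor∣coeff j k+1≤n (lcm∣coeffs j (<⇒≤ k+1≤n))))

    lcm∣coeff : ∀ k → k < n → LcmDivides k
    lcm∣coeff k k<n = lcm∣coeffs n ≤-refl k k<n

    -- For μ(m) ≤ k < n every prime power dividing m divides coeff k, so m does and coeff k = 0.
    coeff-vanishes : ∀ k → k < n → μ m ≤ k → coeff k ≡ 0
    coeff-vanishes k k<n μ≤k = multiple<⇒≡0 (primePowersDivide⇒divides m (coeff k) pp∣coeff) (coeff<m k)
      where
      pp∣coeff : PrimePowersDivide m (coeff k)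
      pp∣coeff q q∣m ppq = small-divisor∣coeff k k<n (lcm∣coeffs k (<⇒≤ k<n)) q q≥1 (≤-trans (primePower∣⇒≤μ m q q∣m ppq) μ≤k) q∣m
        where
        q≥1 : 1 ≤ q
        q≥1 = >-nonZero⁻¹ q {{≢-nonZero λ { refl → ≢-nonZero⁻¹ m (0∣⇒≡0 q∣m) }}}

⊓-≤-below : ∀ {n μ k} → n ⊓ μ ≤ k → k < n → μ ≤ k
⊓-≤-below {n} {μ} N≤k k<n with ≤-total n μ
... | inj₁ n≤μ = ⊥-elim (<⇒≱ k<n (subst (_≤ _) (m≤n⇒m⊓n≡m n≤μ) N≤k))
... | inj₂ μ≤n = subst (_≤ _) (m≥n⇒m⊓n≡n μ≤n) N≤k

module _ (n m : ℕ) .{{_ : NonZero n}} .{{_ : NonZero m}} (f : Fin n → Fin m)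
         (cp : CongruencePreserving n m f) where

  private
    F : ℕ → ℕ
    F x = toℕ (f (fromℕ< (m%n<n x n)))

    toℕ-fromℕ<-% : ∀ {x} → x < n → toℕ (fromℕ< (m%n<n x n)) ≡ x
    toℕ-fromℕ<-% x<n = trans (toℕ-fromℕ< (m%n<n _ n)) (m<n⇒m%n≡m x<n)

    F-toℕ : ∀ i → F (toℕ i) ≡ toℕ (f i)
    F-toℕ i = cong (λ j → toℕ (f j)) (toℕ-injective (toℕ-fromℕ<-% (toℕ<n i)))

    F-cp : ∀ d .{{_ : NonZero d}} → d ∣ m → ∀ x y → x < n → y < n → x ≡ y [mod d ] → F x ≡ F y [mod d ]
    F-cp d d∣m x y x<n y<n x≡y = cp d d∣m _ _
      (trans (cong (_% d) (toℕ-fromℕ<-% x<n)) (trans x≡y (cong (_% d) (sym (toℕ-fromℕ<-% y<n)))))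

  open Newton m F
  open Preserving n F-cp

  private
    N : ℕ
    N = n ⊓ μ m
    N≤n : N ≤ n
    N≤n = m⊓n≤m n (μ m)
    p : ℕ
    p = pred N
    p+1≡N : suc p ≡ N
    p+1≡N = suc-pred N {{>-nonZero (⊓-glb (>-nonZero⁻¹ n) (μ≥1 m))}}
    p<N : p < N
    p<N = subst (p <_) p+1≡N ≤-refl

    a : Fin (suc p) → Fin m
    a k = fromℕ< (coeff<m (toℕ k))

    index<n : ∀ (k : Fin (suc p)) → toℕ k < n
    index<n k = <-≤-trans (toℕ<n k) (subst (_≤ n) (sym p+1≡N) N≤n)

    lcm∣a : ∀ k → DividesMod m (lcmUpTo (toℕ k)) (a k)
    lcm∣a k with lcm∣coeff (toℕ k) (index<n k)
    ... | t , coeff≡Lt = congruence⇒dividesMod {c = lcmUpTo (toℕ k)} t (trans (cong (_% m) (toℕ-fromℕ< (coeff<m (toℕ k)))) coeff≡Lt)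

    newton-n≡newton-N : ∀ x → newton n x ≡ newton (suc p) x
    newton-n≡newton-N x = begin
      newton n x                  ≡⟨ cong (λ z → newton z x) (m+[n∸m]≡n N≤n) ⟨
      newton (N + (n ∸ N)) x      ≡⟨ newton-truncate N (n ∸ N) x vanish ⟩
      newton N x                  ≡⟨ cong (λ z → newton z x) p+1≡N ⟨
      newton (suc p) x            ∎
      where
      open ≡-Reasoning
      vanish : ∀ k → N ≤ k → k < N + (n ∸ N) → coeff k ≡ 0
      vanish k N≤k k<n′ = coeff-vanishes k k<n (⊓-≤-below N≤k k<n)
        where
        k<n : k < n
        k<n = subst (k <_) (m+[n∸m]≡n N≤n) k<n′

    f≡expansion : ∀ x → toℕ (f x) ≡ expansion a (toℕ x) % m
    f≡expansion x = begin
      toℕ (f x)                          ≡⟨ m<n⇒m%n≡m (toℕ<n (f x)) ⟨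
      toℕ (f x) % m                      ≡⟨ cong (_% m) (F-toℕ x) ⟨
      F X % m                            ≡⟨ newton-interpolates n X (toℕ<n x) ⟨
      newton n X % m                     ≡⟨ cong (_% m) (trans (newton-n≡newton-N X) (newton-as-sum (suc p) X)) ⟩
      sumFin {suc p} (λ i → coeff (toℕ i) * (X C toℕ i)) % m
                                         ≡⟨ sumFin-congruence {K = suc p} _ _ termwise ⟨
      expansion a X % m                  ∎
      where
      open ≡-Reasoning
      X : ℕ
      X = toℕ x
      termwise : ∀ (i : Fin (suc p)) → toℕ (a i) * ((X C toℕ i) % m) ≡ coeff (toℕ i) * (X C toℕ i) [mod m ]
      termwise i = mod-* (cong (_% m) (toℕ-fromℕ< (coeff<m (toℕ i)))) (mod-residue (X C toℕ i))

  necessity : Σ ℕ (λ p → p < n ⊓ μ m × Σ (Fin (suc p) → Fin m) (λ a →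
    (∀ x → toℕ (f x) ≡ expansion a (toℕ x) % m) × (∀ k → DividesMod m (lcmUpTo (toℕ k)) (a k))))
  necessity = p , p<N , a , f≡expansion , lcm∣a

theorem3p12 : (n m : ℕ) .{{_ : NonZero n}} .{{_ : NonZero m}} → (f : Fin n → Fin m) →
    CongruencePreserving n m f ⇔
      Σ ℕ (λ p → p < n ⊓ μ m × Σ (Fin (suc p) → Fin m) (λ a →
        (∀ (x : Fin n) → toℕ (f x) ≡ sumFin (λ k → toℕ (a k) * ((toℕ x C toℕ k) % m)) % m)
        × (∀ (k : Fin (suc p)) → DividesMod m (lcmUpTo (toℕ k)) (a k))))
theorem3p12 n m f = mk⇔ (necessity n m f) (λ (_ , _ , a , f≡expansion , lcm∣a) → sufficiency n m f a f≡expansion lcm∣a)
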